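{- Let $q$ be even, $k\ge 1$, $E=\mathbb{F}_q\subseteq F=\mathbb{F}_{q^k}$. Let $V$ be a finite-dimensional $F$-vector space equipped with a quadratic form $Q\colon V\to F$ (not necessarily nondegenerate). If $X$ is an $E$-subspace of $V$ with $|X|>q^{k^2+k}$, then $X$ contains a nonzero vector $v$ with $Q(v)=0$. -}

module Defs where

open import Level using (0ℓ)
open import Data.Nat using (ℕ)
open import Data.Product using (∃; _×_)
open import Data.List using (List; length)
open import Data.List.Membership.Propositional using (_∈_)
open import Data.List.Relation.Unary.Unique.Propositional using (Unique)
open import Data.Vec using (Vec; zipWith; map; replicate)
open import Relation.Binary.PropositionalEquality using (_≡_; _≢_)
open import Relation.Binary.Definitions using (DecidableEquality)
open import Algebra.Structures using (IsCommutativeRing)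

record Field : Set₁ where
  infixl 7 _*_
  infixl 6 _+_
  field
    Carrier : Set
    _+_ _*_ : Carrier → Carrier → Carrier
    -_ : Carrier → Carrier
    0# 1# : Carrier
    isCommutativeRing : IsCommutativeRing _≡_ _+_ _*_ -_ 0# 1#
    0≢1 : 0# ≢ 1#
    inverse : ∀ x → x ≢ 0# → ∃ λ y → x * y ≡ 1#
    _≟_ : DecidableEquality Carrier

  _-_ : Carrier → Carrier → Carrier
  x - y = x + (- y)

HasCard : {A : Set} → List A → ℕ → Set
HasCard xs N = Unique xs × length xs ≡ N

module _ (F : Field) where
  open Field F

  FieldOfOrder : ℕ → Set
  FieldOfOrder N = ∃ λ (xs : List Carrier) → HasCard xs N × (∀ x → x ∈ xs)

  IsSubfield : List Carrier → Set
  IsSubfield Es =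
      0# ∈ Es × 1# ∈ Es
    × (∀ {a b} → a ∈ Es → b ∈ Es → (a + b) ∈ Es)
    × (∀ {a} → a ∈ Es → (- a) ∈ Es)
    × (∀ {a b} → a ∈ Es → b ∈ Es → (a * b) ∈ Es)
    × (∀ {a} → a ∈ Es → (nz : a ≢ 0#) → Data.Product.proj₁ (inverse a nz) ∈ Es)

  Vect : ℕ → Set
  Vect n = Vec Carrier n

  _⊕_ : ∀ {n} → Vect n → Vect n → Vect n
  u ⊕ v = zipWith _+_ u v

  _•_ : ∀ {n} → Carrier → Vect n → Vect n
  c • v = map (c *_) v

  𝟎 : ∀ {n} → Vect n
  𝟎 {n} = replicate n 0#

  IsQuadraticForm : ∀ {n} → (Vect n → Carrier) → Set
  IsQuadraticForm {n} Q =
      (∀ c v → Q (c • v) ≡ (c * c) * Q v)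
    × (∀ u u' v → B (u ⊕ u') v ≡ B u v + B u' v)
    × (∀ c u v → B (c • u) v ≡ c * B u v)
    × (∀ u v v' → B u (v ⊕ v') ≡ B u v + B u v')
    × (∀ c u v → B u (c • v) ≡ c * B u v)
    where
    B : Vect n → Vect n → Carrier
    B u v = (Q (u ⊕ v) - Q u) - Q v

  IsSubspaceOver : ∀ {n} → List Carrier → List (Vect n) → Set
  IsSubspaceOver Es Xs =
      Unique Xs
    × 𝟎 ∈ Xs
    × (∀ {u v} → u ∈ Xs → v ∈ Xs → (u ⊕ v) ∈ Xs)
    × (∀ {c v} → c ∈ Es → v ∈ Xs → (c • v) ∈ Xs)

-- Since |E| is even, F has characteristic 2.  Then the polar form B of Q is alternating, and Q
-- is additive on any subspace on which B vanishes.  Starting from L = 0 and Y = X, repeatedly pick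
-- y ∈ Y ∖ L and replace L by L + E y and Y by Y ∩ y^⊥.  This keeps L inside Y ∩ Y^⊥, multiplies
-- |L| by q, and divides |Y| by at most |F| = q^k, because Y ∩ y^⊥ is the kernel of the additive
-- map B(-, y) : Y → F.  As |X| > q^(k(k+1)), this can be done k + 1 times, giving a totally
-- isotropic L with |L| = q^(k+1) > |F|.  The additive map Q restricted to L then has a nonzero
-- kernel vector, which is the required singular vector.

module Submission where

open import Defs using (Field; HasCard; FieldOfOrder; IsSubfield; Vect; IsQuadraticForm; IsSubspaceOver)
import Defs
open import Level using (0ℓ)
open import Function using (_∘′_)
open import Data.Empty using (⊥-elim)
open import Data.Product using (∃; _×_; _,_; proj₁; proj₂)
open import Data.Sum using (inj₁; inj₂)
open import Data.Nat using (ℕ; zero; suc; _≤_; _<_; z≤n; s≤s; z<s; >-nonZero)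
import Data.Nat as ℕ
import Data.Nat.Properties as ℕ
open import Data.Nat.Divisibility using (_∣_; _∣0; ∣-refl; ∣m∣n⇒∣m+n; ∣1⇒≡1; ∣m+n∣m⇒∣n)
open import Data.List using (List; []; _∷_; [_]; _++_; length; map; filter; cartesianProductWith)
open import Data.List.Properties using (length-++; length-map; length-++-sucʳ)
open import Data.List.Membership.Propositional using (_∈_; _∉_; find)
open import Data.List.Membership.Propositional.Properties
  using (∈-∃++; ∈-++⁻; ∈-++⁺ˡ; ∈-++⁺ʳ; ∈-map⁻; ∈-filter⁺; ∈-filter⁻; ∈-cartesianProductWith⁺; ∈-cartesianProductWith⁻)
import Data.List.Membership.DecPropositional as DecMembership
open import Data.List.Relation.Binary.Subset.Propositional using (_⊆_)
import Data.List.Relation.Binary.Sublist.Propositional.Properties as Sublist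
open import Data.List.Relation.Unary.Any using (here; there)
open import Data.List.Relation.Unary.All as All using ([]; _∷_; all?)
open import Data.List.Relation.Unary.All.Properties using (map⁺; ¬All⇒Any¬)
open import Data.List.Relation.Unary.AllPairs using ([]; _∷_)
open import Data.List.Relation.Unary.Unique.Propositional using (Unique)
import Data.List.Relation.Unary.Unique.Propositional.Properties as Unique
open import Data.Vec using (Vec; []; _∷_)
open import Data.Vec.Properties using (zipWith-comm; zipWith-assoc; zipWith-identityˡ; ≡-dec)
open import Relation.Binary.PropositionalEquality using (_≡_; _≢_; refl; sym; trans; cong; cong₂; subst; module ≡-Reasoning)
open import Relation.Binary.Definitions using (DecidableEquality)
open import Relation.Nullary using (¬_; yes; no)
open import Relation.Unary using (Pred; Decidable)
open import Relation.Unary.Properties using (∁?)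
open import Algebra.Bundles using (CommutativeRing)
open import Algebra.Structures using (IsCommutativeRing)
import Algebra.Properties.Ring as RingProperties

module ListProperties where
  open import Data.Nat using (_+_; _*_)

  module _ {A : Set} where

    ∈-++-skip : ∀ xs {y ys} {z : A} → z ∈ xs ++ ys → z ∈ xs ++ y ∷ ys
    ∈-++-skip xs z∈ with ∈-++⁻ xs z∈
    ... | inj₁ z∈xs = ∈-++⁺ˡ z∈xs
    ... | inj₂ z∈ys = ∈-++⁺ʳ xs (there z∈ys)

    ∈-++-unskip : ∀ xs {y ys} {z : A} → z ∈ xs ++ y ∷ ys → z ≢ y → z ∈ xs ++ ys
    ∈-++-unskip xs z∈ z≢y with ∈-++⁻ xs z∈
    ... | inj₁ z∈xs = ∈-++⁺ˡ z∈xs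
    ... | inj₂ (here z≡y) = ⊥-elim (z≢y z≡y)
    ... | inj₂ (there z∈ys) = ∈-++⁺ʳ xs z∈ys

    Unique-remove : ∀ xs {y : A} {ys} → Unique (xs ++ y ∷ ys) → Unique (xs ++ ys) × y ∉ xs ++ ys
    Unique-remove [] (y∉ys ∷ u) = u , λ y∈ys → All.lookup y∉ys y∈ys refl
    Unique-remove (x ∷ xs) (x∉ ∷ u) =
      let u′ , y∉ = Unique-remove xs u in
        All.tabulate (All.lookup x∉ ∘′ ∈-++-skip xs) ∷ u′
      , λ { (here refl) → All.lookup x∉ (∈-++⁺ʳ xs (here refl)) refl ; (there y∈) → y∉ y∈ }

    length-≤-⊆ : {xs ys : List A} → Unique xs → xs ⊆ ys → length xs ≤ length ys
    length-≤-⊆ {[]} _ _ = z≤n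
    length-≤-⊆ {x ∷ xs} {ys} (x∉xs ∷ u) xs⊆ys with ∈-∃++ (xs⊆ys (here refl))
    ... | as , bs , refl = begin
      suc (length xs)         ≤⟨ s≤s (length-≤-⊆ u xs⊆as++bs) ⟩
      suc (length (as ++ bs)) ≡⟨ length-++-sucʳ as x bs ⟨
      length (as ++ x ∷ bs)   ∎
      where
      open ℕ.≤-Reasoning
      xs⊆as++bs : xs ⊆ as ++ bs
      xs⊆as++bs z∈xs = ∈-++-unskip as (xs⊆ys (there z∈xs)) λ { refl → All.lookup x∉xs z∈xs refl }

    ∈-nonempty : ∀ {m} {xs : List A} → m < length xs → ∃ λ x → x ∈ xs
    ∈-nonempty {xs = x ∷ _} _ = x , here refl

    ∃-∈-≢ : DecidableEquality A → {xs : List A} → Unique xs → 1 < length xs → (a : A) → ∃ λ x → x ∈ xs × x ≢ a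
    ∃-∈-≢ _≟_ {x ∷ []} _ (s≤s ()) _
    ∃-∈-≢ _≟_ {x ∷ x′ ∷ _} ((x≢x′ ∷ _) ∷ _) _ a with x ≟ a
    ... | yes refl = x′ , there (here refl) , λ x′≡x → x≢x′ (sym x′≡x)
    ... | no x≢a   = x , here refl , x≢a

    length-filter-split : {P : Pred A 0ℓ} (P? : Decidable P) (xs : List A) →
      length xs ≡ length (filter P? xs) + length (filter (∁? P?) xs)
    length-filter-split P? [] = refl
    length-filter-split P? (x ∷ xs) with P? x
    ... | yes _ = cong suc (length-filter-split P? xs)
    ... | no _  = trans (cong suc (length-filter-split P? xs)) (sym (ℕ.+-suc _ _))

  module _ {A B C : Set} (f : A → B → C) where

    length-cartesianProductWith : ∀ xs ys → length (cartesianProductWith f xs ys) ≡ length xs * length ys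
    length-cartesianProductWith [] ys = refl
    length-cartesianProductWith (x ∷ xs) ys = begin
      length (map (f x) ys ++ cartesianProductWith f xs ys)          ≡⟨ length-++ (map (f x) ys) ⟩
      length (map (f x) ys) + length (cartesianProductWith f xs ys)  ≡⟨ cong₂ _+_ (length-map (f x) ys) (length-cartesianProductWith xs ys) ⟩
      length ys + length xs * length ys                              ∎
      where open ≡-Reasoning

    Unique-map-injectiveOn : ∀ x {ys} → (∀ {y y′} → y ∈ ys → y′ ∈ ys → f x y ≡ f x y′ → y ≡ y′) →
      Unique ys → Unique (map (f x) ys)
    Unique-map-injectiveOn x {[]} _ [] = []
    Unique-map-injectiveOn x {y ∷ ys} inj (y∉ys ∷ u) =
        map⁺ (All.tabulate λ y′∈ys eq → All.lookup y∉ys y′∈ys (inj (here refl) (there y′∈ys) eq))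
      ∷ Unique-map-injectiveOn x (λ p p′ → inj (there p) (there p′)) u

    Unique-cartesianProductWith : ∀ {xs ys} →
      (∀ {x x′ y y′} → x ∈ xs → x′ ∈ xs → y ∈ ys → y′ ∈ ys → f x y ≡ f x′ y′ → x ≡ x′ × y ≡ y′) →
      Unique xs → Unique ys → Unique (cartesianProductWith f xs ys)
    Unique-cartesianProductWith {[]} _ _ _ = []
    Unique-cartesianProductWith {x ∷ xs} {ys} inj (x∉xs ∷ uxs) uys =
      Unique.++⁺ (Unique-map-injectiveOn x (λ p p′ e → proj₂ (inj (here refl) (here refl) p p′ e)) uys)
                 (Unique-cartesianProductWith (λ p p′ → inj (there p) (there p′)) uxs uys)
                 disjoint
      where
      disjoint : ∀ {z} → ¬ (z ∈ map (f x) ys × z ∈ cartesianProductWith f xs ys)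
      disjoint (z∈map , z∈prod) with ∈-map⁻ (f x) z∈map | ∈-cartesianProductWith⁻ f xs ys z∈prod
      ... | y , y∈ys , refl | x′ , y′ , x′∈xs , y′∈ys , eq =
        All.lookup x∉xs x′∈xs (proj₁ (inj (here refl) (there x′∈xs) y∈ys y′∈ys eq))

  module Pigeonhole {A C : Set} (_≟_ : DecidableEquality C) (g : A → C) where

    fibre : C → List A → List A
    fibre c = filter (λ y → g y ≟ c)

    pigeonhole : ∀ (cs : List C) (ys : List A) m → (∀ {y} → y ∈ ys → g y ∈ cs) →
      length cs * m < length ys → ∃ λ c → m < length (fibre c ys)
    pigeonhole [] (y ∷ ys) m covered _ with covered (here refl)
    ... | ()
    pigeonhole (c ∷ cs) ys m covered cs*m<ys with m ℕ.<? length (fibre c ys)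
    ... | yes m<fibre = c , m<fibre
    ... | no m≮fibre =
      let c′ , m<fibre-rest = pigeonhole cs rest m covered-rest cs*m<rest in
      c′ , ℕ.<-≤-trans m<fibre-rest (Sublist.length-mono-≤ (Sublist.filter⁺ _ _ (λ { refl p → p }) (Sublist.filter-⊆ _ ys)))
      where
      open ℕ.≤-Reasoning
      rest = filter (∁? (λ y → g y ≟ c)) ys
      cs*m<rest : length cs * m < length rest
      cs*m<rest = ℕ.+-cancelˡ-< m _ _ (begin-strict
        m + length cs * m                  <⟨ cs*m<ys ⟩
        length ys                          ≡⟨ length-filter-split (λ y → g y ≟ c) ys ⟩
        length (fibre c ys) + length rest  ≤⟨ ℕ.+-monoˡ-≤ _ (ℕ.≮⇒≥ m≮fibre) ⟩
        m + length rest                    ∎)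
      covered-rest : ∀ {y} → y ∈ rest → g y ∈ cs
      covered-rest y∈rest with ∈-filter⁻ (∁? (λ y → g y ≟ c)) y∈rest
      ... | y∈ys , gy≢c with covered y∈ys
      ... | here gy≡c = ⊥-elim (gy≢c gy≡c)
      ... | there gy∈cs = gy∈cs

  module _ {A : Set} (f : A → A) (f-involutive : ∀ x → f (f x) ≡ x) where

    involution-swap : ∀ {a b} → f a ≡ b → a ≡ f b
    involution-swap {a} refl = sym (f-involutive a)

    2∣length-fixedPointFree : ∀ m {xs} → length xs ≡ m → Unique xs →
      (∀ {x} → x ∈ xs → f x ∈ xs) → (∀ {x} → x ∈ xs → f x ≢ x) → 2 ∣ m
    2∣length-fixedPointFree zero _ _ _ _ = 2 ∣0
    2∣length-fixedPointFree (suc zero) {x ∷ []} _ _ closed fixedPointFree with closed (here refl)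
    ... | here fx≡x = ⊥-elim (fixedPointFree (here refl) fx≡x)
    2∣length-fixedPointFree (suc (suc m)) {x ∷ xs} |xs|≡ (x∉xs ∷ u) closed fixedPointFree
      with closed (here refl)
    ... | here fx≡x = ⊥-elim (fixedPointFree (here refl) fx≡x)
    ... | there fx∈xs with ∈-∃++ fx∈xs
    ... | as , bs , refl =
      ∣m∣n⇒∣m+n ∣-refl (2∣length-fixedPointFree m |rest|≡m u′ closed′ (fixedPointFree ∘′ there ∘′ ∈-++-skip as))
      where
      u′ = proj₁ (Unique-remove as u)
      fx∉rest = proj₂ (Unique-remove as u)
      |rest|≡m : length (as ++ bs) ≡ m
      |rest|≡m = ℕ.suc-injective (trans (sym (length-++-sucʳ as (f x) bs)) (ℕ.suc-injective |xs|≡))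
      closed′ : ∀ {z} → z ∈ as ++ bs → f z ∈ as ++ bs
      closed′ {z} z∈rest with closed (there (∈-++-skip as z∈rest))
      ... | here fz≡x = ⊥-elim (fx∉rest (subst (_∈ as ++ bs) (involution-swap fz≡x) z∈rest))
      ... | there fz∈xs = ∈-++-unskip as fz∈xs λ fz≡fx →
        All.lookup x∉xs (∈-++-skip as z∈rest) (sym (trans (involution-swap fz≡fx) (f-involutive x)))

open ListProperties

m+[1+n]≡1+k⇒m≤k*[1+n] : ∀ {m n k} → m ℕ.+ suc n ≡ suc k → m ≤ k ℕ.* suc n
m+[1+n]≡1+k⇒m≤k*[1+n] {m} {n} {k} eq = begin
  m              ≤⟨ ℕ.m≤m+n m n ⟩
  m ℕ.+ n        ≡⟨ ℕ.suc-injective (trans (sym (ℕ.+-suc m n)) eq) ⟩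
  k              ≤⟨ ℕ.m≤m+n k (k ℕ.* n) ⟩
  k ℕ.+ k ℕ.* n  ≡⟨ ℕ.*-suc k n ⟨
  k ℕ.* suc n    ∎
  where open ℕ.≤-Reasoning

HasCharacteristic2 : Field → Set
HasCharacteristic2 F = 1# + 1# ≡ 0#
  where open Field F

module FieldProperties (F : Field) where
  open Field F
  open IsCommutativeRing isCommutativeRing public
    using (+-comm; +-assoc; +-identityˡ; +-identityʳ; -‿inverseʳ; *-comm; *-assoc; *-identityˡ; *-identityʳ; distribˡ; distribʳ; zeroˡ; zeroʳ)

  commutativeRing : CommutativeRing 0ℓ 0ℓ
  commutativeRing = record { isCommutativeRing = isCommutativeRing }

  open RingProperties (CommutativeRing.ring commutativeRing) public using (-‿involutive; -0#≈0#)

  module Subfield {Es : List Carrier} (Es-subfield : IsSubfield F Es) where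

    0∈E : 0# ∈ Es
    0∈E = proj₁ Es-subfield

    1∈E : 1# ∈ Es
    1∈E = proj₁ (proj₂ Es-subfield)

    +∈E : ∀ {c d} → c ∈ Es → d ∈ Es → c + d ∈ Es
    +∈E = proj₁ (proj₂ (proj₂ Es-subfield))

    -∈E : ∀ {c} → c ∈ Es → - c ∈ Es
    -∈E = proj₁ (proj₂ (proj₂ (proj₂ Es-subfield)))

    *∈E : ∀ {c d} → c ∈ Es → d ∈ Es → c * d ∈ Es
    *∈E = proj₁ (proj₂ (proj₂ (proj₂ (proj₂ Es-subfield))))

    ⁻¹∈E : ∀ {c} → c ∈ Es → (c≢0 : c ≢ 0#) → proj₁ (inverse c c≢0) ∈ Es
    ⁻¹∈E = proj₂ (proj₂ (proj₂ (proj₂ (proj₂ Es-subfield))))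

  x+x≡[1+1]x : ∀ x → x + x ≡ (1# + 1#) * x
  x+x≡[1+1]x x = sym (trans (distribʳ x 1# 1#) (cong₂ _+_ (*-identityˡ x) (*-identityˡ x)))

  -x≢x : 1# + 1# ≢ 0# → ∀ {x} → x ≢ 0# → - x ≢ x
  -x≢x 1+1≢0 {x} x≢0 -x≡x = 1+1≢0 (begin
    1# + 1#                ≡⟨ *-identityʳ (1# + 1#) ⟨
    (1# + 1#) * 1#         ≡⟨ cong ((1# + 1#) *_) x*x⁻¹≡1 ⟨
    (1# + 1#) * (x * x⁻¹)  ≡⟨ *-assoc (1# + 1#) x x⁻¹ ⟨
    ((1# + 1#) * x) * x⁻¹  ≡⟨ cong (_* x⁻¹) (x+x≡[1+1]x x) ⟨
    (x + x) * x⁻¹          ≡⟨ cong (λ t → (x + t) * x⁻¹) -x≡x ⟨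
    (x + - x) * x⁻¹        ≡⟨ cong (_* x⁻¹) (-‿inverseʳ x) ⟩
    0# * x⁻¹               ≡⟨ zeroˡ x⁻¹ ⟩
    0#                     ∎)
    where
    open ≡-Reasoning
    x⁻¹ = proj₁ (inverse x x≢0)
    x*x⁻¹≡1 = proj₂ (inverse x x≢0)

  -- If 1 + 1 ≢ 0 then x ↦ - x is a fixed-point-free involution of E ∖ {0}, so |E| is odd.
  characteristic2 : ∀ {Es} → Unique Es → 0# ∈ Es → (∀ {x} → x ∈ Es → - x ∈ Es) →
    2 ∣ length Es → 1# + 1# ≡ 0#
  characteristic2 {Es} uEs 0∈Es closed 2∣|E| with (1# + 1#) ≟ 0#
  ... | yes 1+1≡0 = 1+1≡0
  ... | no 1+1≢0 with ∈-∃++ 0∈Es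
  ... | as , bs , refl = ⊥-elim (2≢1 (∣1⇒≡1 (∣m+n∣m⇒∣n 2∣|E|′ 2∣|rest|)))
    where
    u′ = proj₁ (Unique-remove as uEs)
    0∉rest = proj₂ (Unique-remove as uEs)
    nonzero : ∀ {x} → x ∈ as ++ bs → x ≢ 0#
    nonzero x∈ refl = 0∉rest x∈
    closed′ : ∀ {x} → x ∈ as ++ bs → - x ∈ as ++ bs
    closed′ {x} x∈ = ∈-++-unskip as (closed (∈-++-skip as x∈))
      λ -x≡0 → nonzero x∈ (trans (sym (-‿involutive x)) (trans (cong -_ -x≡0) -0#≈0#))
    2∣|rest| : 2 ∣ length (as ++ bs)
    2∣|rest| = 2∣length-fixedPointFree -_ -‿involutive _ refl u′ closed′ (λ x∈ → -x≢x 1+1≢0 (nonzero x∈))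
    2∣|E|′ : 2 ∣ length (as ++ bs) ℕ.+ 1
    2∣|E|′ = subst (2 ∣_) (trans (length-++-sucʳ as 0# bs) (ℕ.+-comm 1 _)) 2∣|E|
    2≢1 : 2 ≢ 1
    2≢1 ()

module Vectors (F : Field) where
  open Field F
  open FieldProperties F

  infixl 6 _⊕_
  infixr 7 _•_

  _⊕_ : ∀ {n} → Vect F n → Vect F n → Vect F n
  _⊕_ = Defs._⊕_ F

  _•_ : ∀ {n} → Carrier → Vect F n → Vect F n
  _•_ = Defs._•_ F

  𝟎 : ∀ {n} → Vect F n
  𝟎 = Defs.𝟎 F

  ⊕-comm : ∀ {n} (u v : Vect F n) → u ⊕ v ≡ v ⊕ u
  ⊕-comm = zipWith-comm +-comm

  ⊕-assoc : ∀ {n} (u v w : Vect F n) → (u ⊕ v) ⊕ w ≡ u ⊕ (v ⊕ w)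
  ⊕-assoc = zipWith-assoc +-assoc

  ⊕-identityˡ : ∀ {n} (u : Vect F n) → 𝟎 ⊕ u ≡ u
  ⊕-identityˡ = zipWith-identityˡ +-identityˡ

  ⊕-interchange : ∀ {n} (u v w x : Vect F n) → (u ⊕ v) ⊕ (w ⊕ x) ≡ (u ⊕ w) ⊕ (v ⊕ x)
  ⊕-interchange u v w x = begin
    (u ⊕ v) ⊕ (w ⊕ x) ≡⟨ ⊕-assoc u v (w ⊕ x) ⟩
    u ⊕ (v ⊕ (w ⊕ x)) ≡⟨ cong (u ⊕_) (⊕-assoc v w x) ⟨
    u ⊕ ((v ⊕ w) ⊕ x) ≡⟨ cong (λ t → u ⊕ (t ⊕ x)) (⊕-comm v w) ⟩
    u ⊕ ((w ⊕ v) ⊕ x) ≡⟨ cong (u ⊕_) (⊕-assoc w v x) ⟩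
    u ⊕ (w ⊕ (v ⊕ x)) ≡⟨ ⊕-assoc u w (v ⊕ x) ⟨
    (u ⊕ w) ⊕ (v ⊕ x) ∎
    where open ≡-Reasoning

  •-distribˡ-⊕ : ∀ {n} c (u v : Vect F n) → c • (u ⊕ v) ≡ c • u ⊕ c • v
  •-distribˡ-⊕ c [] [] = refl
  •-distribˡ-⊕ c (a ∷ u) (b ∷ v) = cong₂ _∷_ (distribˡ c a b) (•-distribˡ-⊕ c u v)

  •-distribʳ-+ : ∀ {n} c d (u : Vect F n) → (c + d) • u ≡ c • u ⊕ d • u
  •-distribʳ-+ c d [] = refl
  •-distribʳ-+ c d (a ∷ u) = cong₂ _∷_ (distribʳ a c d) (•-distribʳ-+ c d u)

  •-assoc : ∀ {n} c d (u : Vect F n) → (c * d) • u ≡ c • d • u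
  •-assoc c d [] = refl
  •-assoc c d (a ∷ u) = cong₂ _∷_ (*-assoc c d a) (•-assoc c d u)

  •-identityˡ : ∀ {n} (u : Vect F n) → 1# • u ≡ u
  •-identityˡ [] = refl
  •-identityˡ (a ∷ u) = cong₂ _∷_ (*-identityˡ a) (•-identityˡ u)

  •-zeroˡ : ∀ {n} (u : Vect F n) → 0# • u ≡ 𝟎
  •-zeroˡ [] = refl
  •-zeroˡ (a ∷ u) = cong₂ _∷_ (zeroˡ a) (•-zeroˡ u)

  •-zeroʳ : ∀ {n} c → c • 𝟎 {n} ≡ 𝟎
  •-zeroʳ {zero} c = refl
  •-zeroʳ {suc n} c = cong₂ _∷_ (zeroʳ c) (•-zeroʳ c)

module Characteristic2 (F : Field) (1+1≡0 : HasCharacteristic2 F) where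
  open Field F
  open FieldProperties F
  open Vectors F

  x+x≡0 : ∀ x → x + x ≡ 0#
  x+x≡0 x = trans (x+x≡[1+1]x x) (trans (cong (_* x) 1+1≡0) (zeroˡ x))

  x+[x+y]≡y : ∀ x y → x + (x + y) ≡ y
  x+[x+y]≡y x y = trans (sym (+-assoc x x y)) (trans (cong (_+ y) (x+x≡0 x)) (+-identityˡ y))

  x+y≡0⇒x≡y : ∀ {x y} → x + y ≡ 0# → x ≡ y
  x+y≡0⇒x≡y {x} {y} x+y≡0 = begin
    x            ≡⟨ x+[x+y]≡y y x ⟨
    y + (y + x)  ≡⟨ cong (y +_) (trans (+-comm y x) x+y≡0) ⟩
    y + 0#       ≡⟨ +-identityʳ y ⟩
    y            ∎
    where open ≡-Reasoning

  -x≡x : ∀ x → - x ≡ x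
  -x≡x x = sym (x+y≡0⇒x≡y (-‿inverseʳ x))

  ⊕-self : ∀ {n} (u : Vect F n) → u ⊕ u ≡ 𝟎
  ⊕-self [] = refl
  ⊕-self (a ∷ u) = cong₂ _∷_ (x+x≡0 a) (⊕-self u)

  u⊕[u⊕v]≡v : ∀ {n} (u v : Vect F n) → u ⊕ (u ⊕ v) ≡ v
  u⊕[u⊕v]≡v u v = trans (sym (⊕-assoc u u v)) (trans (cong (_⊕ v) (⊕-self u)) (⊕-identityˡ v))

  ⊕-cancelˡ : ∀ {n} (u : Vect F n) {v w} → u ⊕ v ≡ u ⊕ w → v ≡ w
  ⊕-cancelˡ u {v} {w} eq = trans (sym (u⊕[u⊕v]≡v u v)) (trans (cong (u ⊕_) eq) (u⊕[u⊕v]≡v u w))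

  ⊕-cancelʳ : ∀ {n} (u : Vect F n) {v w} → v ⊕ u ≡ w ⊕ u → v ≡ w
  ⊕-cancelʳ u {v} {w} eq = ⊕-cancelˡ u (trans (⊕-comm u v) (trans eq (⊕-comm w u)))

  ⊕-transpose : ∀ {n} {u v a b : Vect F n} → u ⊕ a ≡ v ⊕ b → v ⊕ u ≡ b ⊕ a
  ⊕-transpose {u = u} {v} {a} {b} eq = ⊕-cancelʳ a (begin
    (v ⊕ u) ⊕ a  ≡⟨ ⊕-assoc v u a ⟩
    v ⊕ (u ⊕ a)  ≡⟨ cong (v ⊕_) eq ⟩
    v ⊕ (v ⊕ b)  ≡⟨ u⊕[u⊕v]≡v v b ⟩
    b            ≡⟨ u⊕[u⊕v]≡v a b ⟨
    a ⊕ (a ⊕ b)  ≡⟨ ⊕-comm a (a ⊕ b) ⟩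
    (a ⊕ b) ⊕ a  ≡⟨ cong (_⊕ a) (⊕-comm a b) ⟩
    (b ⊕ a) ⊕ a  ∎)
    where open ≡-Reasoning

module QuadraticForm (F : Field) (1+1≡0 : HasCharacteristic2 F)
  {n : ℕ} (Q : Vect F n → Field.Carrier F) (isQ : IsQuadraticForm F Q) where
  open Field F
  open FieldProperties F
  open Vectors F
  open Characteristic2 F 1+1≡0

  B : Vect F n → Vect F n → Carrier
  B u v = (Q (u ⊕ v) - Q u) - Q v

  Q-homogeneous : ∀ c v → Q (c • v) ≡ (c * c) * Q v
  Q-homogeneous = proj₁ isQ

  B-additiveˡ : ∀ u u′ v → B (u ⊕ u′) v ≡ B u v + B u′ v
  B-additiveˡ = proj₁ (proj₂ isQ)

  B-homogeneousˡ : ∀ c u v → B (c • u) v ≡ c * B u v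
  B-homogeneousˡ = proj₁ (proj₂ (proj₂ isQ))

  Q-𝟎 : Q 𝟎 ≡ 0#
  Q-𝟎 = begin
    Q 𝟎               ≡⟨ cong Q (•-zeroʳ 0#) ⟨
    Q (0# • 𝟎)        ≡⟨ Q-homogeneous 0# 𝟎 ⟩
    (0# * 0#) * Q 𝟎   ≡⟨ cong (_* Q 𝟎) (zeroˡ 0#) ⟩
    0# * Q 𝟎          ≡⟨ zeroˡ (Q 𝟎) ⟩
    0#                ∎
    where open ≡-Reasoning

  B-zeroˡ : ∀ v → B 𝟎 v ≡ 0#
  B-zeroˡ v = begin
    B 𝟎 v          ≡⟨ cong (λ u → B u v) (•-zeroʳ 0#) ⟨
    B (0# • 𝟎) v   ≡⟨ B-homogeneousˡ 0# 𝟎 v ⟩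
    0# * B 𝟎 v     ≡⟨ zeroˡ (B 𝟎 v) ⟩
    0#             ∎
    where open ≡-Reasoning

  B-sym : ∀ u v → B u v ≡ B v u
  B-sym u v = begin
    (Q (u ⊕ v) + - Q u) + - Q v  ≡⟨ +-assoc _ _ _ ⟩
    Q (u ⊕ v) + (- Q u + - Q v)  ≡⟨ cong₂ (λ w t → Q w + t) (⊕-comm u v) (+-comm _ _) ⟩
    Q (v ⊕ u) + (- Q v + - Q u)  ≡⟨ +-assoc _ _ _ ⟨
    (Q (v ⊕ u) + - Q v) + - Q u  ∎
    where open ≡-Reasoning

  B-self : ∀ u → B u u ≡ 0#
  B-self u = begin
    (Q (u ⊕ u) + - Q u) + - Q u  ≡⟨ cong (λ w → (Q w + - Q u) + - Q u) (⊕-self u) ⟩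
    (Q 𝟎 + - Q u) + - Q u        ≡⟨ cong (λ t → (t + - Q u) + - Q u) Q-𝟎 ⟩
    (0# + - Q u) + - Q u         ≡⟨ cong (_+ - Q u) (+-identityˡ (- Q u)) ⟩
    - Q u + - Q u                ≡⟨ x+x≡0 (- Q u) ⟩
    0#                           ∎
    where open ≡-Reasoning

  Q-additive-⊥ : ∀ u v → B u v ≡ 0# → Q (u ⊕ v) ≡ Q u + Q v
  Q-additive-⊥ u v Buv≡0 = begin
    Q (u ⊕ v)                  ≡⟨ x+[x+y]≡y (Q u) (Q (u ⊕ v)) ⟨
    Q u + (Q u + Q (u ⊕ v))    ≡⟨ cong (Q u +_) (+-comm (Q u) (Q (u ⊕ v))) ⟩
    Q u + (Q (u ⊕ v) + Q u)    ≡⟨ cong (λ t → Q u + (Q (u ⊕ v) + t)) (-x≡x (Q u)) ⟨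
    Q u + (Q (u ⊕ v) + - Q u)  ≡⟨ cong (Q u +_) (trans (x+y≡0⇒x≡y Buv≡0) (-x≡x (Q v))) ⟩
    Q u + Q v                  ∎
    where open ≡-Reasoning

  B-⊕•-zeroˡ : ∀ {w y x} c → B w x ≡ 0# → B y x ≡ 0# → B (w ⊕ c • y) x ≡ 0#
  B-⊕•-zeroˡ {w} {y} {x} c Bwx≡0 Byx≡0 = begin
    B (w ⊕ c • y) x      ≡⟨ B-additiveˡ w (c • y) x ⟩
    B w x + B (c • y) x  ≡⟨ cong₂ _+_ Bwx≡0 (B-homogeneousˡ c y x) ⟩
    0# + c * B y x       ≡⟨ cong (λ t → 0# + c * t) Byx≡0 ⟩
    0# + c * 0#          ≡⟨ trans (+-identityˡ _) (zeroʳ c) ⟩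
    0#                   ∎
    where open ≡-Reasoning

module Subspaces (F : Field) (1+1≡0 : HasCharacteristic2 F)
  {n : ℕ} (Es : List (Field.Carrier F)) (Es-subfield : IsSubfield F Es) where
  open Field F
  open FieldProperties F
  open Vectors F
  open Characteristic2 F 1+1≡0

  open Subfield Es-subfield

  private
    V = Vect F n

  Subspace : List V → Set
  Subspace = IsSubspaceOver F Es

  subspace-unique : ∀ {L} → Subspace L → Unique L
  subspace-unique = proj₁

  subspace-⊕ : ∀ {L} → Subspace L → ∀ {u v} → u ∈ L → v ∈ L → u ⊕ v ∈ L
  subspace-⊕ = proj₁ ∘′ proj₂ ∘′ proj₂

  subspace-• : ∀ {L} → Subspace L → ∀ {c v} → c ∈ Es → v ∈ L → c • v ∈ L
  subspace-• = proj₂ ∘′ proj₂ ∘′ proj₂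

  [𝟎]-subspace : Subspace [ 𝟎 ]
  [𝟎]-subspace = [] ∷ [] , here refl , (λ { (here refl) (here refl) → here (⊕-identityˡ 𝟎) })
                                     , (λ { _ (here refl) → here (•-zeroʳ _) })

  kernel : (V → Carrier) → List V → List V
  kernel f = filter (λ x → f x ≟ 0#)

  ∈-kernel⁺ : ∀ f {Ys x} → x ∈ Ys → f x ≡ 0# → x ∈ kernel f Ys
  ∈-kernel⁺ f = ∈-filter⁺ (λ x → f x ≟ 0#)

  ∈-kernel⁻ : ∀ f {Ys x} → x ∈ kernel f Ys → x ∈ Ys × f x ≡ 0#
  ∈-kernel⁻ f {Ys} = ∈-filter⁻ (λ x → f x ≟ 0#) {xs = Ys}

  kernel-subspace : ∀ f → (∀ u v → f (u ⊕ v) ≡ f u + f v) → (∀ c v → f (c • v) ≡ c * f v) →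
    ∀ {Ys} → Subspace Ys → Subspace (kernel f Ys)
  kernel-subspace f additive homogeneous {Ys} (uYs , 𝟎∈Ys , ⊕-closed , •-closed) =
    Unique.filter⁺ _ uYs , ∈-kernel⁺ f 𝟎∈Ys f𝟎≡0 , ⊕-closed′ , •-closed′
    where
    f𝟎≡0 : f 𝟎 ≡ 0#
    f𝟎≡0 = trans (cong f (sym (•-zeroʳ 0#))) (trans (homogeneous 0# 𝟎) (zeroˡ (f 𝟎)))
    ⊕-closed′ : ∀ {u v} → u ∈ kernel f Ys → v ∈ kernel f Ys → u ⊕ v ∈ kernel f Ys
    ⊕-closed′ {u} {v} u∈ v∈ with ∈-kernel⁻ f u∈ | ∈-kernel⁻ f v∈
    ... | u∈Ys , fu≡0 | v∈Ys , fv≡0 = ∈-kernel⁺ f (⊕-closed u∈Ys v∈Ys)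
      (trans (additive u v) (trans (cong₂ _+_ fu≡0 fv≡0) (+-identityˡ 0#)))
    •-closed′ : ∀ {c v} → c ∈ Es → v ∈ kernel f Ys → c • v ∈ kernel f Ys
    •-closed′ {c} {v} c∈Es v∈ with ∈-kernel⁻ f v∈
    ... | v∈Ys , fv≡0 = ∈-kernel⁺ f (•-closed c∈Es v∈Ys)
      (trans (homogeneous c v) (trans (cong (c *_) fv≡0) (zeroʳ c)))

  -- The translate x₀ ⊕ fibre f a of a large fibre lies in the kernel, as f x₀ + f x = a + a = 0.
  kernel-large : ∀ f (Fs : List Carrier) → (∀ a → a ∈ Fs) → ∀ {Ys} → Unique Ys →
    (∀ {u v} → u ∈ Ys → v ∈ Ys → u ⊕ v ∈ Ys) →
    (∀ {u v} → u ∈ Ys → v ∈ Ys → f (u ⊕ v) ≡ f u + f v) →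
    ∀ m → length Fs ℕ.* m < length Ys → m < length (kernel f Ys)
  kernel-large f Fs all∈Fs {Ys} uYs ⊕-closed additive m Fs*m<Ys
    with Pigeonhole.pigeonhole _≟_ f Fs Ys m (λ _ → all∈Fs _) Fs*m<Ys
  ... | a , m<fibre with ∈-nonempty m<fibre
  ... | x₀ , x₀∈fibre = ℕ.<-≤-trans m<fibre (begin
    length fibre                   ≡⟨ length-map (x₀ ⊕_) fibre ⟨
    length (map (x₀ ⊕_) fibre)     ≤⟨ length-≤-⊆ (Unique.map⁺ (⊕-cancelˡ x₀) (Unique.filter⁺ _ uYs)) translate ⟩
    length (kernel f Ys)           ∎)
    where
    open ℕ.≤-Reasoning
    fibre = Pigeonhole.fibre _≟_ f a Ys
    translate : map (x₀ ⊕_) fibre ⊆ kernel f Ys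
    translate v∈ with ∈-map⁻ (x₀ ⊕_) v∈
    ... | x , x∈fibre , refl with ∈-filter⁻ _ {xs = Ys} x₀∈fibre | ∈-filter⁻ _ {xs = Ys} x∈fibre
    ... | x₀∈Ys , fx₀≡a | x∈Ys , fx≡a = ∈-kernel⁺ f (⊕-closed x₀∈Ys x∈Ys)
      (trans (additive x₀∈Ys x∈Ys) (trans (cong₂ _+_ fx₀≡a fx≡a) (x+x≡0 a)))

  ∈-unscale : ∀ {L c v} → Subspace L → c ∈ Es → (c≢0 : c ≢ 0#) → c • v ∈ L → v ∈ L
  ∈-unscale {L} {c} {v} (_ , _ , _ , •-closed) c∈Es c≢0 cv∈L =
    subst (_∈ L) c⁻¹cv≡v (•-closed (⁻¹∈E c∈Es c≢0) cv∈L)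
    where
    c⁻¹ = proj₁ (inverse c c≢0)
    c⁻¹cv≡v : c⁻¹ • c • v ≡ v
    c⁻¹cv≡v = begin
      c⁻¹ • c • v    ≡⟨ •-assoc c⁻¹ c v ⟨
      (c⁻¹ * c) • v  ≡⟨ cong (_• v) (trans (*-comm c⁻¹ c) (proj₂ (inverse c c≢0))) ⟩
      1# • v         ≡⟨ •-identityˡ v ⟩
      v              ∎
      where open ≡-Reasoning

  extend : List V → V → List V
  extend L y = cartesianProductWith (λ c w → w ⊕ c • y) Es L

  length-extend : ∀ L y → length (extend L y) ≡ length Es ℕ.* length L
  length-extend L y = length-cartesianProductWith _ Es L

  extend-injective : ∀ {L y} → Subspace L → y ∉ L → ∀ {c d w x} → c ∈ Es → d ∈ Es → w ∈ L → x ∈ L →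
    w ⊕ c • y ≡ x ⊕ d • y → c ≡ d × w ≡ x
  extend-injective {L} {y} L-subspace y∉L {c} {d} {w} {x} c∈Es d∈Es w∈L x∈L eq with c ≟ d
  ... | yes refl = refl , ⊕-cancelʳ (c • y) eq
  ... | no c≢d = ⊥-elim (y∉L (∈-unscale L-subspace (+∈E d∈Es c∈Es) d+c≢0 [d+c]y∈L))
    where
    d+c≢0 : d + c ≢ 0#
    d+c≢0 d+c≡0 = c≢d (sym (x+y≡0⇒x≡y d+c≡0))
    [d+c]y∈L : (d + c) • y ∈ L
    [d+c]y∈L = subst (_∈ L) (trans (⊕-transpose eq) (sym (•-distribʳ-+ d c y)))
      (subspace-⊕ L-subspace x∈L w∈L)

  extend-subspace : Unique Es → ∀ {L y} → Subspace L → y ∉ L → Subspace (extend L y)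
  extend-subspace uEs {L} {y} L-subspace@(uL , 𝟎∈L , ⊕-closed , •-closed) y∉L =
      Unique-cartesianProductWith _ (extend-injective L-subspace y∉L) uEs uL
    , subst (_∈ extend L y) (trans (cong (𝟎 ⊕_) (•-zeroˡ y)) (⊕-identityˡ 𝟎))
        (∈-cartesianProductWith⁺ _ 0∈E 𝟎∈L)
    , ⊕-closed′
    , •-closed′
    where
    ⊕-closed′ : ∀ {u v} → u ∈ extend L y → v ∈ extend L y → u ⊕ v ∈ extend L y
    ⊕-closed′ u∈ v∈ with ∈-cartesianProductWith⁻ _ Es L u∈ | ∈-cartesianProductWith⁻ _ Es L v∈
    ... | c , w , c∈Es , w∈L , refl | d , x , d∈Es , x∈L , refl =
      subst (_∈ extend L y)
        (trans (cong ((w ⊕ x) ⊕_) (•-distribʳ-+ c d y)) (⊕-interchange w x (c • y) (d • y)))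
        (∈-cartesianProductWith⁺ _ (+∈E c∈Es d∈Es) (⊕-closed w∈L x∈L))
    •-closed′ : ∀ {e v} → e ∈ Es → v ∈ extend L y → e • v ∈ extend L y
    •-closed′ {e} e∈Es v∈ with ∈-cartesianProductWith⁻ _ Es L v∈
    ... | c , w , c∈Es , w∈L , refl =
      subst (_∈ extend L y)
        (trans (cong (e • w ⊕_) (•-assoc e c y)) (sym (•-distribˡ-⊕ e w (c • y))))
        (∈-cartesianProductWith⁺ _ (*∈E e∈Es c∈Es) (•-closed e∈Es w∈L))

module Descent (F : Field) (1+1≡0 : HasCharacteristic2 F)
  {n : ℕ} (Q : Vect F n → Field.Carrier F) (isQ : IsQuadraticForm F Q)
  (Es : List (Field.Carrier F)) (Es-subfield : IsSubfield F Es) (uEs : Unique Es)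
  (Fs : List (Field.Carrier F)) (all∈Fs : ∀ a → a ∈ Fs) where
  open import Data.Nat using (_+_; _*_; _^_)
  open import Data.Nat.Properties using (+-identityʳ; +-suc; *-suc; *-identityʳ; ^-distribˡ-+-*; ^-monoʳ-≤; ^-monoʳ-<;
                n<1+n; <-trans; <⇒≱; module ≤-Reasoning)
  open Field F using (0#; _≟_)
  open Vectors F
  open QuadraticForm F 1+1≡0 Q isQ
  open Subspaces F 1+1≡0 {n} Es Es-subfield
  open DecMembership (≡-dec {n = n} _≟_) using (_∈?_)

  private
    V = Vect F n

  record OrthogonalSubspace (L Ys : List V) : Set where
    field
      L-subspace  : Subspace L
      Ys-subspace : Subspace Ys
      L⊆Ys        : L ⊆ Ys
      L⊥Ys        : ∀ {w x} → w ∈ L → x ∈ Ys → B w x ≡ 0#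

  orthogonalSubspace-𝟎 : ∀ {Ys} → Subspace Ys → OrthogonalSubspace [ 𝟎 ] Ys
  orthogonalSubspace-𝟎 Ys-subspace@(_ , 𝟎∈Ys , _ , _) = record
    { L-subspace  = [𝟎]-subspace
    ; Ys-subspace = Ys-subspace
    ; L⊆Ys        = λ { (here refl) → 𝟎∈Ys }
    ; L⊥Ys        = λ { (here refl) _ → B-zeroˡ _ }
    }

  orthogonalSubspace-extend : ∀ {L Ys y} → OrthogonalSubspace L Ys → y ∈ Ys → y ∉ L →
    OrthogonalSubspace (extend L y) (kernel (λ x → B x y) Ys)
  orthogonalSubspace-extend {L} {Ys} {y} o y∈Ys y∉L = record
    { L-subspace  = extend-subspace uEs L-subspace y∉L
    ; Ys-subspace = kernel-subspace (λ x → B x y) (λ u v → B-additiveˡ u v y) (λ c v → B-homogeneousˡ c v y) Ys-subspace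
    ; L⊆Ys        = L′⊆Ys′
    ; L⊥Ys        = L′⊥Ys′
    }
    where
    open OrthogonalSubspace o
    L′⊆Ys′ : extend L y ⊆ kernel (λ x → B x y) Ys
    L′⊆Ys′ v∈ with ∈-cartesianProductWith⁻ _ Es L v∈
    ... | c , w , c∈Es , w∈L , refl =
      ∈-kernel⁺ (λ x → B x y) (subspace-⊕ Ys-subspace (L⊆Ys w∈L) (subspace-• Ys-subspace c∈Es y∈Ys))
        (B-⊕•-zeroˡ c (L⊥Ys w∈L y∈Ys) (B-self y))
    L′⊥Ys′ : ∀ {v x} → v ∈ extend L y → x ∈ kernel (λ x → B x y) Ys → B v x ≡ 0#
    L′⊥Ys′ v∈ x∈ with ∈-cartesianProductWith⁻ _ Es L v∈ | ∈-kernel⁻ (λ z → B z y) {Ys} x∈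
    ... | c , w , c∈Es , w∈L , refl | x∈Ys , Bxy≡0 =
      B-⊕•-zeroˡ c (L⊥Ys w∈L x∈Ys) (trans (B-sym y _) Bxy≡0)

  totallyIsotropic⇒singular : ∀ {L} → Subspace L → (∀ {w x} → w ∈ L → x ∈ L → B w x ≡ 0#) →
    length Fs < length L → ∃ λ v → v ∈ L × v ≢ 𝟎 × Q v ≡ 0#
  totallyIsotropic⇒singular {L} L-subspace L⊥L |F|<|L| =
    let v , v∈ker , v≢𝟎 = ∃-∈-≢ (≡-dec _≟_) (Unique.filter⁺ _ uL) 1<|ker| 𝟎
        v∈L , Qv≡0      = ∈-kernel⁻ Q v∈ker
    in v , v∈L , v≢𝟎 , Qv≡0
    where
    uL = subspace-unique L-subspace
    1<|ker| : 1 < length (kernel Q L)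
    1<|ker| = kernel-large Q Fs all∈Fs uL (subspace-⊕ L-subspace) (λ u∈L v∈L → Q-additive-⊥ _ _ (L⊥L u∈L v∈L)) 1
      (subst (_< length L) (sym (*-identityʳ (length Fs))) |F|<|L|)

  module _ (q k : ℕ) (1<q : 1 < q) (|E|≡q : length Es ≡ q) (|F|≡q^k : length Fs ≡ q ^ k) where

    q^[k*[1+j]]≡|F|*q^[k*j] : ∀ j → q ^ (k * suc j) ≡ length Fs * q ^ (k * j)
    q^[k*[1+j]]≡|F|*q^[k*j] j = begin
      q ^ (k * suc j)          ≡⟨ cong (q ^_) (*-suc k j) ⟩
      q ^ (k + k * j)          ≡⟨ ^-distribˡ-+-* q k (k * j) ⟩
      q ^ k * q ^ (k * j)      ≡⟨ cong (_* q ^ (k * j)) |F|≡q^k ⟨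
      length Fs * q ^ (k * j)  ∎
      where open ≡-Reasoning

    -- Invariant: |L| = q^s with s + j = k + 1, and |Y| > q^(kj) ≥ |L|, so some y ∈ Y lies outside L.
    descend : ∀ j {s L Ys} → s + j ≡ suc k → length L ≡ q ^ s → q ^ (k * j) < length Ys →
      OrthogonalSubspace L Ys → ∃ λ v → v ∈ Ys × v ≢ 𝟎 × Q v ≡ 0#
    descend zero {s} {L} s+0≡1+k |L|≡q^s _ o =
      let v , v∈L , v≢𝟎 , Qv≡0 = totallyIsotropic⇒singular L-subspace (λ w∈L x∈L → L⊥Ys w∈L (L⊆Ys x∈L)) |F|<|L|
      in v , L⊆Ys v∈L , v≢𝟎 , Qv≡0
      where
      open OrthogonalSubspace o
      open ≤-Reasoning
      |F|<|L| : length Fs < length L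
      |F|<|L| = begin-strict
        length Fs  ≡⟨ |F|≡q^k ⟩
        q ^ k      <⟨ ^-monoʳ-< q 1<q (n<1+n k) ⟩
        q ^ suc k  ≡⟨ cong (q ^_) (trans (sym s+0≡1+k) (+-identityʳ s)) ⟩
        q ^ s      ≡⟨ |L|≡q^s ⟨
        length L   ∎
    descend (suc j) {s} {L} {Ys} s+1+j≡1+k |L|≡q^s q^[k*[1+j]]<|Y| o with all? (_∈? L) Ys
    ... | yes Ys⊆L = ⊥-elim (<⇒≱ q^[k*[1+j]]<|Y| (begin
        length Ys        ≤⟨ length-≤-⊆ (subspace-unique Ys-subspace) (All.lookup Ys⊆L) ⟩
        length L         ≡⟨ |L|≡q^s ⟩
        q ^ s            ≤⟨ ^-monoʳ-≤ q {{>-nonZero (<-trans z<s 1<q)}} (m+[1+n]≡1+k⇒m≤k*[1+n] s+1+j≡1+k) ⟩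
        q ^ (k * suc j)  ∎))
      where
      open OrthogonalSubspace o
      open ≤-Reasoning
    ... | no Ys⊈L with find (¬All⇒Any¬ (_∈? L) Ys Ys⊈L)
    ... | y , y∈Ys , y∉L =
      let v , v∈Y′ , v≢𝟎 , Qv≡0 = descend j (trans (sym (+-suc s j)) s+1+j≡1+k) |L′|≡q^[1+s] q^[kj]<|Y′|
                                       (orthogonalSubspace-extend o y∈Ys y∉L)
      in v , proj₁ (∈-kernel⁻ (λ x → B x y) v∈Y′) , v≢𝟎 , Qv≡0
      where
      open OrthogonalSubspace o
      |L′|≡q^[1+s] : length (extend L y) ≡ q ^ suc s
      |L′|≡q^[1+s] = trans (length-extend L y) (cong₂ _*_ |E|≡q |L|≡q^s)
      q^[kj]<|Y′| : q ^ (k * j) < length (kernel (λ x → B x y) Ys)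
      q^[kj]<|Y′| = kernel-large (λ x → B x y) Fs all∈Fs (subspace-unique Ys-subspace) (subspace-⊕ Ys-subspace)
        (λ {u} {v} _ _ → B-additiveˡ u v y) (q ^ (k * j))
        (subst (_< length Ys) (q^[k*[1+j]]≡|F|*q^[k*j] j) q^[k*[1+j]]<|Y|)

open Defs using (𝟎)
open import Data.Nat using (_≥_; _>_; _*_; _+_; _^_)

lemma4p3 : (q k : ℕ) → 2 ∣ q → k ≥ 1 →
    (F : Field) → FieldOfOrder F (q ^ k) →
    (Es : List (Field.Carrier F)) → IsSubfield F Es → HasCard Es q →
    (n : ℕ) → (Q : Vec (Field.Carrier F) n → Field.Carrier F) → IsQuadraticForm F Q →
    (Xs : List (Vec (Field.Carrier F) n)) → IsSubspaceOver F Es Xs →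
    length Xs > q ^ (k * k + k) →
    ∃ λ v → v ∈ Xs × v ≢ 𝟎 F × Q v ≡ Field.0# F
lemma4p3 q k 2∣q _ F (Fs , (_ , |F|≡q^k) , all∈Fs) Es Es-subfield (uEs , |E|≡q) n Q isQ Xs Xs-subspace q^[k*k+k]<|X| =
  descend q k 1<q |E|≡q |F|≡q^k (suc k) {0} refl refl q^[k*[1+k]]<|X| (orthogonalSubspace-𝟎 Xs-subspace)
  where
  open Field F using (0≢1)
  0∈E = proj₁ Es-subfield
  1∈E = proj₁ (proj₂ Es-subfield)
  1+1≡0 = FieldProperties.characteristic2 F uEs 0∈E (proj₁ (proj₂ (proj₂ (proj₂ Es-subfield))))
            (subst (2 ∣_) (sym |E|≡q) 2∣q)
  1<q : 1 < q
  1<q = subst (1 <_) |E|≡q (length-≤-⊆ ((0≢1 ∷ []) ∷ [] ∷ []) λ { (here refl) → 0∈E ; (there (here refl)) → 1∈E })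
  open Descent F 1+1≡0 Q isQ Es Es-subfield uEs Fs all∈Fs
  q^[k*[1+k]]<|X| : q ^ (k * suc k) < length Xs
  q^[k*[1+k]]<|X| = subst (λ e → q ^ e < length Xs) (trans (ℕ.+-comm (k * k) k) (sym (ℕ.*-suc k k))) q^[k*k+k]<|X|
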